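{- For every finite or infinite sequence $\mathbf f$ over $\{ -1,1\}$, the run-length sequence $R_{\mathbf f}$ is overlap-free, i.e. it contains no factor of the form $axaxa$ with $a$ a single letter and $x$ a possibly empty word.
   Context: For a finite sequence $\mathbf f$ over $\{ -1,1\}$ define $P_\epsilon=\epsilon$ (empty) and $P_{\mathbf f a}=P_{\mathbf f}\ a\ (-P_{\mathbf f}^R)$ for $a\in\{ -1,1\}$, where $-x$ negates every entry and $x^R$ is reversal. For an infinite $\mathbf f=f_0f_1\cdots$, $P_{\mathbf f}$ is the unique infinite sequence having every $P_{f_0\cdots f_n}$ as a prefix. A run is a maximal block of consecutive identical entries; the run-length sequence $R_{\mathbf f}$ is the sequence of lengths of the runs of $P_{\mathbf f}$ from left to right (a word over $\{1,2,3\}$). A factor is a contiguous block. -}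

module Defs where

open import Data.Nat using (ℕ; zero; suc; _+_; _<_; _≥_)
open import Data.List using (List; []; _∷_; _++_; reverse; map; take; length)
open import Data.Sign using (Sign; opposite) renaming (+ to plus; - to minus)
open import Data.Sign.Properties using (_≟_)
open import Data.Product using (Σ; ∃; _×_; _,_)
open import Data.Sum using (_⊎_)
open import Data.Unit using (⊤)
open import Relation.Nullary using (¬_; yes; no)
open import Relation.Binary.PropositionalEquality using (_≡_; _≢_)

-- Signs ±1 are represented by Data.Sign.Sign (plus = 1, minus = -1).

negRev : List Sign → List Sign
negRev x = map opposite (reverse x)

-- P_{g a} = P_g a (-P_g^R), computed by reading f left to right.
-- Pacc acc f = P_{h f} where acc = P_h.
Pacc : List Sign → List Sign → List Sign
Pacc acc []      = acc
Pacc acc (a ∷ f) = Pacc (acc ++ (a ∷ negRev acc)) f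

P : List Sign → List Sign
P f = Pacc [] f

runsFrom : Sign → ℕ → List Sign → List ℕ
runsFrom c k []       = k ∷ []
runsFrom c k (y ∷ ys) with y ≟ c
... | yes _ = runsFrom c (suc k) ys
... | no  _ = k ∷ runsFrom y 1 ys

runLengths : List Sign → List ℕ
runLengths []       = []
runLengths (x ∷ xs) = runsFrom x 1 xs

OverlapFree : List ℕ → Set
OverlapFree w = ¬ (Σ (List ℕ) λ u → Σ (List ℕ) λ v → Σ ℕ λ a → Σ (List ℕ) λ x →
                   w ≡ u ++ (a ∷ x ++ (a ∷ x ++ (a ∷ v))))

IsPrefixOf : List Sign → (ℕ → Sign) → Set
IsPrefixOf []      s = ⊤
IsPrefixOf (x ∷ l) s = (s 0 ≡ x) × IsPrefixOf l (λ i → s (suc i))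

takeSeq : ℕ → (ℕ → Sign) → List Sign
takeSeq zero    f = []
takeSeq (suc n) f = f 0 ∷ takeSeq n (λ i → f (suc i))

RunStart : (ℕ → Sign) → ℕ → Set
RunStart s p = (p ≡ 0) ⊎ (Σ ℕ λ q → (p ≡ suc q) × (s q ≢ s p))

RunsAt : (ℕ → Sign) → ℕ → List ℕ → Set
RunsAt s p []      = ⊤
RunsAt s p (l ∷ w) = (l ≥ 1) × ((∀ j → j < l → s (p + j) ≡ s p))
                     × (s (p + l) ≢ s p) × RunsAt s (p + l) w

RunFactor : (ℕ → Sign) → List ℕ → Set
RunFactor s w = Σ ℕ λ p → RunStart s p × RunsAt s p w

RunsOverlapFree : (ℕ → Sign) → Set
RunsOverlapFree s = (a : ℕ) → (x : List ℕ) → ¬ RunFactor s (a ∷ x ++ (a ∷ x ++ (a ∷ [])))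

module Submission where

-- The unfolding P (a ∷ g) = weave a (P g) shows that the even positions of P_f alternate
-- a, -a, a, … while its odd positions carry P_g. Hence every P_f is a prefix of a
-- paperfolding sequence s: one whose even positions alternate and whose odd subsequence is
-- again paperfolding. Since the even positions alternate, the k-th run of s begins at 2k or
-- at 2k - 1 according as s(2k-2)·s(2k-1) is + or -, so the run lengths are a sliding function
-- of the sign sequence u(m) = s(2m)·s(2m+1), which is itself paperfolding. An overlap a x a x a
-- with period L = |a x| among the run lengths therefore forces a factor of u with period L and
-- length 2L + 2 (2L + 1 at the start of u). No paperfolding sequence has such a factor: an
-- odd period contradicts the alternation of the even positions, and an even period 2Q forces
-- Q to be even and passes to the odd subsequence with period Q.

open import Defs
open import Data.Nat using (ℕ; zero; suc; _+_; _∸_; _≤_; _<_; z≤n; s≤s)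
open import Data.Nat.Properties
  using (suc-injective; +-suc; +-assoc; +-comm; +-identityʳ; +-mono-≤; m≤m+n)
open import Data.Nat.Properties using (≤-refl; ≤-trans; ≤-pred; n≤1+n; <-cmp; m≤n⇒m<n∨m≡n)
open import Data.Nat.Tactic.RingSolver using (solve-∀)
open import Data.List using (List; []; _∷_; _++_; length; map; reverse)
open import Data.List.Properties using (∷-injective; ∷-injectiveˡ; ∷-injectiveʳ; ++-assoc; ++-conicalʳ)
open import Data.List.Properties using (length-++; map-++; reverse-++; length-map; length-reverse)
open import Data.Sign using (Sign; opposite; _*_) renaming (+ to plus; - to minus)
open import Data.Sign.Properties using (_≟_; s≢opposite[s]; s*s≡+; s*opposite[s]≡-; opposite-involutive; opposite-injective)
open import Data.Product using (Σ; _×_; _,_; proj₁; proj₂)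
open import Data.Sum using (inj₁; inj₂)
open import Data.Unit using (⊤; tt)
open import Data.Empty using (⊥; ⊥-elim)
open import Relation.Nullary using (yes; no)
open import Relation.Binary.Definitions using (tri<; tri≈; tri>)
open import Relation.Binary.PropositionalEquality

data Parity : ℕ → Set where
  even : ∀ k → Parity (k + k)
  odd  : ∀ k → Parity (suc (k + k))

parity : ∀ n → Parity n
parity zero = even zero
parity (suc n) with parity n
... | even k = odd k
... | odd k  = subst Parity (cong suc (+-suc k k)) (even (suc k))

[m+n]+[m+n]≡[m+m]+[n+n] : ∀ m n → (m + n) + (m + n) ≡ (m + m) + (n + n)
[m+n]+[m+n]≡[m+m]+[n+n] = solve-∀

[1+m]+[1+m]≡2+[m+m] : ∀ m → suc m + suc m ≡ suc (suc (m + m))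
[1+m]+[1+m]≡2+[m+m] m = cong suc (+-suc m m)

1≤n+n⇒1≤n : ∀ n → 1 ≤ n + n → 1 ≤ n
1≤n+n⇒1≤n (suc n) _ = s≤s z≤n

n+n≤1+d⇒n≤d : ∀ {n d} → 1 ≤ n → n + n ≤ suc d → n ≤ d
n+n≤1+d⇒n≤d {suc n} {d} _ le = ≤-trans (s≤s (m≤m+n n n)) (≤-pred (subst (_≤ suc d) ([1+m]+[1+m]≡2+[m+m] n) le))

m<n⇒1+m+m<n+n : ∀ {m n} → m < n → suc (m + m) < n + n
m<n⇒1+m+m<n+n {m} {n} m<n = subst (_≤ n + n) ([1+m]+[1+m]≡2+[m+m] m) (+-mono-≤ m<n m<n)

opposite^ : ℕ → Sign → Sign
opposite^ zero    x = x
opposite^ (suc n) x = opposite (opposite^ n x)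

opposite^-opposite : ∀ n x → opposite^ n (opposite x) ≡ opposite (opposite^ n x)
opposite^-opposite zero    x = refl
opposite^-opposite (suc n) x = cong opposite (opposite^-opposite n x)

opposite^-+ : ∀ m n x → opposite^ m (opposite^ n x) ≡ opposite^ (m + n) x
opposite^-+ zero    n x = refl
opposite^-+ (suc m) n x = cong opposite (opposite^-+ m n x)

opposite^-even : ∀ r x → opposite^ (r + r) x ≡ x
opposite^-even zero    x = refl
opposite^-even (suc r) x rewrite +-suc r r = trans (opposite-involutive _) (opposite^-even r x)

opposite^-odd : ∀ r x → opposite^ (suc (r + r)) x ≢ x
opposite^-odd r x eq = s≢opposite[s] x (sym (trans (cong opposite (sym (opposite^-even r x))) eq))

opposite^-fixed : ∀ j x → opposite^ j x ≡ x → Σ ℕ λ r → j ≡ r + r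
opposite^-fixed j x eq with parity j
... | even r = r , refl
... | odd r  with () ← opposite^-odd r x eq

≢⇒opposite : ∀ {x y : Sign} → x ≢ y → y ≡ opposite x
≢⇒opposite {plus}  {plus}  x≢y = ⊥-elim (x≢y refl)
≢⇒opposite {plus}  {minus} _   = refl
≢⇒opposite {minus} {plus}  _   = refl
≢⇒opposite {minus} {minus} x≢y = ⊥-elim (x≢y refl)

x*y≡+⇒y≡x : ∀ {x y} → x * y ≡ plus → y ≡ x
x*y≡+⇒y≡x {plus}  {plus}  _ = refl
x*y≡+⇒y≡x {minus} {minus} _ = refl

x*y≡-⇒y≢x : ∀ {x y} → x * y ≡ minus → y ≢ x
x*y≡-⇒y≢x {plus}  {plus}  () _
x*y≡-⇒y≢x {minus} {minus} () _

y≡x⇒x*y≡+ : ∀ {x y} → y ≡ x → x * y ≡ plus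
y≡x⇒x*y≡+ {x} refl = s*s≡+ x

y≢x⇒x*y≡- : ∀ {x y} → y ≢ x → x * y ≡ minus
y≢x⇒x*y≡- {x} y≢x =
  subst (λ y → x * y ≡ minus) (sym (≢⇒opposite (λ eq → y≢x (sym eq)))) (s*opposite[s]≡- x)

*-opposite : ∀ c y → c * opposite y ≡ opposite (c * y)
*-opposite plus  y = refl
*-opposite minus y = refl

-- Paperfolding sequences

Alternating : (ℕ → Sign) → Set
Alternating w = ∀ m → w (suc (suc (m + m))) ≡ opposite (w (m + m))

odds : (ℕ → Sign) → ℕ → Sign
odds w m = w (suc (m + m))

Folding : ℕ → (ℕ → Sign) → Set
Folding zero    w = ⊤
Folding (suc n) w = Alternating w × Folding n (odds w)

Paperfolding : (ℕ → Sign) → Set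
Paperfolding w = ∀ n → Folding n w

Folding-cong : ∀ n {v w : ℕ → Sign} → (∀ m → v m ≡ w m) → Folding n w → Folding n v
Folding-cong zero    v≗w _            = tt
Folding-cong (suc n) v≗w (alt , fold) =
  (λ m → trans (v≗w _) (trans (alt m) (cong opposite (sym (v≗w _))))) ,
  Folding-cong n (λ m → v≗w (suc (m + m))) fold

Folding-scale : ∀ n c {w} → Folding n w → Folding n (λ m → c * w m)
Folding-scale zero    c _            = tt
Folding-scale (suc n) c (alt , fold) =
  (λ m → trans (cong (c *_) (alt m)) (*-opposite c _)) , Folding-scale n c fold

alternating-shift : ∀ w → Alternating w → ∀ m j → w ((m + j) + (m + j)) ≡ opposite^ j (w (m + m))
alternating-shift w alt m zero    rewrite +-identityʳ m = refl
alternating-shift w alt m (suc j) =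
  trans (cong w (trans (cong (λ t → t + t) (+-suc m j)) ([1+m]+[1+m]≡2+[m+m] (m + j))))
        (trans (alt (m + j)) (cong opposite (alternating-shift w alt m j)))

alternating-return : ∀ w → Alternating w → ∀ e j → w ((e + j) + (e + j)) ≡ w (e + e) → Σ ℕ λ r → j ≡ r + r
alternating-return w alt e j eq = opposite^-fixed j _ (trans (sym (alternating-shift w alt e j)) eq)

alternating-jump : ∀ w → Alternating w → ∀ m → w (suc (suc (m + m))) ≢ w (m + m)
alternating-jump w alt m eq = s≢opposite[s] _ (trans (sym eq) (alt m))

-- Paperfolding sequences have no long periodic factors

Periodic : (ℕ → Sign) → ℕ → ℕ → ℕ → Set
Periodic w p n q = ∀ i → i < n → w (p + i + q) ≡ w (p + i)

periodic-at : ∀ w {p n q} → Periodic w p n q → ∀ i {a b} → i < n → p + i ≡ a → a + q ≡ b → w b ≡ w a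
periodic-at w per i i<n refl refl = per i i<n

-- Whether the window starts at 2k or 2k+1, its first even position 2e has w (2e + 2Q) ≡ w (2e),
-- so Q = r + r by alternation; the odd positions of the window then form a window of odds w
-- with length and period r + r, one folding level deeper.
even-period : ∀ d {w} → Folding d w → ∀ {Q p n} → 1 ≤ Q → Q ≤ d → Q + Q ≤ n → Periodic w p n (Q + Q) → ⊥
even-period zero _ (s≤s _) () _ _
even-period (suc d) {w} (alt , fold) {Q} {p} Q≥1 Q≤d QQ≤n per with parity p
... | even k
    with alternating-return w alt k Q
           (periodic-at w per 0 (≤-trans Q≥1 (≤-trans (m≤m+n Q Q) QQ≤n))
              (+-identityʳ _) (sym ([m+n]+[m+n]≡[m+m]+[n+n] k Q)))
... | r , refl =
  even-period d fold {p = k} (1≤n+n⇒1≤n r Q≥1) (n+n≤1+d⇒n≤d (1≤n+n⇒1≤n r Q≥1) Q≤d) ≤-refl λ j j<r+r →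
    periodic-at w per (suc (j + j)) (≤-trans (m<n⇒1+m+m<n+n j<r+r) QQ≤n)
      (trans (+-suc (k + k) (j + j)) (cong suc (sym ([m+n]+[m+n]≡[m+m]+[n+n] k j))))
      (cong suc (sym ([m+n]+[m+n]≡[m+m]+[n+n] (k + j) (r + r))))
even-period (suc d) {w} (alt , fold) {Q} Q≥1 Q≤d QQ≤n per | odd k
    with alternating-return w alt (suc k) Q
           (periodic-at w per 1 (≤-trans (+-mono-≤ Q≥1 Q≥1) QQ≤n)
              (cong suc (trans (+-comm (k + k) 1) (sym (+-suc k k)))) (sym ([m+n]+[m+n]≡[m+m]+[n+n] (suc k) Q)))
... | r , refl =
  even-period d fold {p = k} (1≤n+n⇒1≤n r Q≥1) (n+n≤1+d⇒n≤d (1≤n+n⇒1≤n r Q≥1) Q≤d) ≤-refl λ j j<r+r →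
    periodic-at w per (j + j) (≤-trans (n≤1+n _) (≤-trans (m<n⇒1+m+m<n+n j<r+r) QQ≤n))
      (cong suc (sym ([m+n]+[m+n]≡[m+m]+[n+n] k j)))
      (cong suc (sym ([m+n]+[m+n]≡[m+m]+[n+n] (k + j) (r + r))))

odd-period : ∀ w → Alternating w → ∀ {e Q n} → suc (Q + Q) < n → Periodic w (e + e) n (suc (Q + Q)) → ⊥
odd-period w alt {e} {Q} q<n per = opposite^-odd Q (w (e + e)) (sym (begin
    w (e + e)                 ≡˘⟨ periodic-at w per 0 (≤-trans (s≤s z≤n) q<n) (+-identityʳ _) refl ⟩
    w (e + e + q)             ≡˘⟨ periodic-at w per q q<n refl
                                    (trans (+-assoc (e + e) q q) (sym ([m+n]+[m+n]≡[m+m]+[n+n] e q))) ⟩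
    w ((e + q) + (e + q))     ≡⟨ alternating-shift w alt e q ⟩
    opposite^ q (w (e + e))   ∎))
  where
  open ≡-Reasoning
  q = suc (Q + Q)

no-period-from-even : ∀ {w} → Paperfolding w → ∀ {k q n} → 1 ≤ q → q < n → Periodic w (k + k) n q → ⊥
no-period-from-even {w} pf {k} {q} q≥1 q<n per with parity q
... | even Q = even-period Q (pf Q) {p = k + k} (1≤n+n⇒1≤n Q q≥1) ≤-refl (≤-trans (n≤1+n _) q<n) per
... | odd Q  = odd-period w (proj₁ (pf 1)) {e = k} {Q = Q} q<n per

no-period : ∀ {w} → Paperfolding w → ∀ {p q n} → 1 ≤ q → suc q < n → Periodic w p n q → ⊥
no-period {w} pf {p} q≥1 q+1<n per with parity p
... | even k = no-period-from-even pf {k = k} q≥1 (≤-trans (n≤1+n _) q+1<n) per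
no-period {w} pf {q = q} {suc n} q≥1 q+1<n per | odd k =
  no-period-from-even pf {k = suc k} q≥1 (≤-pred q+1<n) shifted
  where
  shifted : Periodic w (suc k + suc k) n q
  shifted i i<n = periodic-at w per (suc i) (s≤s i<n)
                    (cong suc (trans (+-suc (k + k) i) (cong (_+ i) (sym (+-suc k k))))) refl

-- Runs of a paperfolding sequence

record MaximalRun (s : ℕ → Sign) (p l : ℕ) : Set where
  constructor maximalRun
  field
    constant : ∀ j → j < l → s (p + j) ≡ s p
    boundary : s (p + l) ≢ s p

maximalRun-unique : ∀ {s p l l′} → MaximalRun s p l → MaximalRun s p l′ → l ≡ l′
maximalRun-unique {l = l} {l′} (maximalRun const end) (maximalRun const′ end′) with <-cmp l l′
... | tri< l<l′ _ _ = ⊥-elim (end (const′ l l<l′))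
... | tri≈ _ l≡l′ _ = l≡l′
... | tri> _ _ l′<l = ⊥-elim (end′ (const l′ l′<l))

maximalRun-extendˡ : ∀ {s p l} → s (suc p) ≡ s p → MaximalRun s (suc p) l → MaximalRun s p (suc l)
maximalRun-extendˡ {s} {p} {l} step (maximalRun const end) =
  maximalRun const′ λ eq → end (trans (cong s (sym (+-suc p l))) (trans eq (sym step)))
  where
  const′ : ∀ j → j < suc l → s (p + j) ≡ s p
  const′ zero    _         = cong s (+-identityʳ p)
  const′ (suc j) (s≤s j<l) = trans (cong s (+-suc p j)) (trans (const j j<l) step)

bit : Sign → ℕ
bit plus  = 0
bit minus = 1

maximalRun-before-jump : ∀ s e → s (suc (suc e)) ≢ s e → MaximalRun s e (2 ∸ bit (s e * s (suc e)))
maximalRun-before-jump s e jump with s e * s (suc e) in eq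
... | plus  = maximalRun const λ eq′ → jump (trans (cong s (+-comm 2 e)) eq′)
  where
  const : ∀ j → j < 2 → s (e + j) ≡ s e
  const zero          _ = cong s (+-identityʳ e)
  const (suc zero)    _ = trans (cong s (+-comm e 1)) (x*y≡+⇒y≡x eq)
  const (suc (suc j)) (s≤s (s≤s ()))
... | minus = maximalRun (λ { zero _ → cong s (+-identityʳ e) ; (suc j) (s≤s ()) })
                         λ eq′ → x*y≡-⇒y≢x eq (trans (cong s (+-comm 1 e)) eq′)

pairSign : (ℕ → Sign) → ℕ → Sign
pairSign s m = s (m + m) * s (suc (m + m))

-- For an alternating s the k-th run begins at 2k - bit (runShift s k): runShift s k is minus
-- exactly when s (2k-2) ≠ s (2k-1). The first run begins at 0, so runShift s 0 = plus and the
-- truncated subtraction in runBegin never truncates.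
runShift : (ℕ → Sign) → ℕ → Sign
runShift s zero    = plus
runShift s (suc m) = pairSign s m

runBegin : (ℕ → Sign) → ℕ → ℕ
runBegin s k = (k + k) ∸ bit (runShift s k)

gap : Sign → Sign → ℕ
gap x y = (2 + bit x) ∸ bit y

runLength : (ℕ → Sign) → ℕ → ℕ
runLength s k = gap (runShift s k) (runShift s (suc k))

gap-minus : ∀ y → gap minus y ≡ suc (gap plus y)
gap-minus plus  = refl
gap-minus minus = refl

maximalRun-runBegin : ∀ s → Alternating s → ∀ k → MaximalRun s (runBegin s k) (runLength s k)
maximalRun-runBegin s alt zero = maximalRun-before-jump s 0 (alternating-jump s alt 0)
maximalRun-runBegin s alt (suc m) with pairSign s m in eq
... | plus  = maximalRun-before-jump s (suc m + suc m) (alternating-jump s alt (suc m))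
... | minus = subst (MaximalRun s (m + suc m)) (sym (gap-minus (pairSign s (suc m))))
                (maximalRun-extendˡ step
                  (maximalRun-before-jump s (suc m + suc m) (alternating-jump s alt (suc m))))
  where
  open ≡-Reasoning
  step : s (suc m + suc m) ≡ s (m + suc m)
  step = begin
    s (suc m + suc m)       ≡⟨ cong s ([1+m]+[1+m]≡2+[m+m] m) ⟩
    s (suc (suc (m + m)))   ≡⟨ alt m ⟩
    opposite (s (m + m))    ≡˘⟨ ≢⇒opposite (λ e → x*y≡-⇒y≢x eq (sym e)) ⟩
    s (suc (m + m))         ≡˘⟨ cong s (+-suc m m) ⟩
    s (m + suc m)           ∎

runBegin-gap : ∀ n x y → (suc n ∸ bit x) + gap x y ≡ suc (suc (suc n)) ∸ bit y
runBegin-gap n plus  plus  = +-comm (suc n) 2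
runBegin-gap n plus  minus = +-comm (suc n) 1
runBegin-gap n minus plus  = +-comm n 3
runBegin-gap n minus minus = +-comm n 2

runBegin-step : ∀ s k → runBegin s k + runLength s k ≡ runBegin s (suc k)
runBegin-step s zero    = refl
runBegin-step s (suc m) =
  trans (runBegin-gap (m + suc m) (pairSign s m) (pairSign s (suc m)))
        (cong (λ n → suc (suc n) ∸ bit (pairSign s (suc m))) (sym (+-suc m (suc m))))

runStart⇒runBegin : ∀ s → Alternating s → ∀ {p} → RunStart s p → Σ ℕ λ k → p ≡ runBegin s k
runStart⇒runBegin s alt (inj₁ refl) = 0 , refl
runStart⇒runBegin s alt (inj₂ (q , refl , jump)) with parity q
... | even m = suc m ,
  sym (trans (cong (λ x → (suc m + suc m) ∸ bit x) (y≢x⇒x*y≡- (λ e → jump (sym e)))) (+-suc m m))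
... | odd m  = suc m ,
  sym (trans (cong (λ x → (suc m + suc m) ∸ bit x) (y≡x⇒x*y≡+ pair-equal)) ([1+m]+[1+m]≡2+[m+m] m))
  where
  pair-equal : s (suc (m + m)) ≡ s (m + m)
  pair-equal = opposite-injective (trans (sym (≢⇒opposite jump)) (alt m))

segment : ∀ {A : Set} → (ℕ → A) → ℕ → ℕ → List A
segment f k zero    = []
segment f k (suc n) = f k ∷ segment f (suc k) n

runsAt-runBegin : ∀ s → Alternating s → ∀ k ws → RunsAt s (runBegin s k) ws →
                  ws ≡ segment (runLength s) k (length ws)
runsAt-runBegin s alt k []       _                     = refl
runsAt-runBegin s alt k (l ∷ ws) (_ , const , end , rest) =
  cong₂ _∷_ l≡ (runsAt-runBegin s alt (suc k) ws (subst (λ p → RunsAt s p ws) next rest))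
  where
  l≡ : l ≡ runLength s k
  l≡ = maximalRun-unique (maximalRun const end) (maximalRun-runBegin s alt k)
  next : runBegin s k + l ≡ runBegin s (suc k)
  next = trans (cong (runBegin s k +_) l≡) (runBegin-step s k)

pairSign-alternating : ∀ s → Folding 2 s → Alternating (pairSign s)
pairSign-alternating s (alt , alt-odds , _) m =
  trans (cong₂ _*_ evens (alt-odds m)) (*-opposite (s (a + a)) (s (suc (a + a))))
  where
  a = m + m
  evens : s (suc (suc a) + suc (suc a)) ≡ s (a + a)
  evens = trans (cong s (cong (λ t → t + t) (+-comm 2 a)))
                (trans (alternating-shift s alt a 2) (opposite-involutive _))

pairSign-paperfolding : ∀ {s} → Paperfolding s → Paperfolding (pairSign s)
pairSign-paperfolding {s} pf zero    = tt
pairSign-paperfolding {s} pf (suc n) =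
  pairSign-alternating s (pf 2) ,
  Folding-cong n odd-pairs (Folding-scale n (s 2) (proj₂ (proj₂ (pf (suc (suc n))))))
  where
  odd-pairs : ∀ m → odds (pairSign s) m ≡ s 2 * odds (odds s) m
  odd-pairs m = cong (_* odds (odds s) m)
                     (trans (alternating-shift s (proj₁ (pf 1)) 1 (m + m)) (opposite^-even m (s 2)))

-- Overlapping runs

++-injective-length : ∀ {A : Set} (xs ys : List A) {zs ws} → length xs ≡ length ys →
                      xs ++ zs ≡ ys ++ ws → xs ≡ ys × zs ≡ ws
++-injective-length []       []       _   eq = refl , eq
++-injective-length (x ∷ xs) (y ∷ ys) len eq with ∷-injective eq
... | refl , eq′ with ++-injective-length xs ys (suc-injective len) eq′
...   | refl , eq″ = refl , eq″

length-segment : ∀ {A : Set} (f : ℕ → A) k n → length (segment f k n) ≡ n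
length-segment f k zero    = refl
length-segment f k (suc n) = cong suc (length-segment f (suc k) n)

segment-++ : ∀ {A : Set} (f : ℕ → A) k m n → segment f k (m + n) ≡ segment f k m ++ segment f (k + m) n
segment-++ f k zero    n = cong (λ k′ → segment f k′ n) (sym (+-identityʳ k))
segment-++ f k (suc m) n =
  cong (f k ∷_) (trans (segment-++ f (suc k) m n)
                       (cong (λ k′ → segment f (suc k) m ++ segment f k′ n) (sym (+-suc k m))))

segment-split : ∀ {A : Set} (f : ℕ → A) k (us vs : List A) → us ++ vs ≡ segment f k (length (us ++ vs)) →
                us ≡ segment f k (length us) × vs ≡ segment f (k + length us) (length vs)
segment-split f k us vs eq =
  ++-injective-length us (segment f k (length us)) (sym (length-segment f k (length us)))
    (trans eq (trans (cong (segment f k) (length-++ us)) (segment-++ f k (length us) (length vs))))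

segment-≡ : ∀ {A : Set} (f : ℕ → A) k k′ n → segment f k n ≡ segment f k′ n →
            ∀ i → i < n → f (k + i) ≡ f (k′ + i)
segment-≡ f k k′ (suc n) eq zero    _         =
  trans (cong f (+-identityʳ k)) (trans (∷-injectiveˡ eq) (cong f (sym (+-identityʳ k′))))
segment-≡ f k k′ (suc n) eq (suc i) (s≤s i<n) =
  trans (cong f (+-suc k i)) (trans (segment-≡ f (suc k) (suc k′) n (∷-injectiveʳ eq) i i<n) (cong f (sym (+-suc k′ i))))

-- Both a x a and its shift by |a x| are the factor a ∷ x ++ a ∷ [] of the overlap.
overlap-period : ∀ {A : Set} (f : ℕ → A) k a x →
                 let o = a ∷ x ++ a ∷ x ++ a ∷ [] in o ≡ segment f k (length o) →
                 ∀ i → i ≤ suc (length x) → f (k + i) ≡ f (k + suc (length x) + i)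
overlap-period f k a x eq i i≤ =
  segment-≡ f k (k + suc (length x)) (length axa) (trans (sym first) second) i
    (s≤s (subst (i ≤_) (trans (+-comm 1 (length x)) (sym (length-++ x))) i≤))
  where
  axa = a ∷ x ++ a ∷ []
  second : axa ≡ segment f (k + suc (length x)) (length axa)
  second = proj₂ (segment-split f k (a ∷ x) axa eq)
  regroup : a ∷ x ++ axa ≡ axa ++ x ++ a ∷ []
  regroup = cong (a ∷_) (sym (++-assoc x (a ∷ []) (x ++ a ∷ [])))
  first : axa ≡ segment f k (length axa)
  first = proj₁ (segment-split f k axa (x ++ a ∷ [])
            (trans (sym regroup) (trans eq (cong (λ o → segment f k (length o)) regroup))))

gap-≡-same : ∀ x {x′ y′} → gap x x′ ≡ gap x y′ → x′ ≡ y′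
gap-≡-same plus  {plus}  {plus}  _ = refl
gap-≡-same plus  {minus} {minus} _ = refl
gap-≡-same minus {plus}  {plus}  _ = refl
gap-≡-same minus {minus} {minus} _ = refl
gap-≡-same plus  {plus}  {minus} ()
gap-≡-same plus  {minus} {plus}  ()
gap-≡-same minus {plus}  {minus} ()
gap-≡-same minus {minus} {plus}  ()

gap-≡-differ : ∀ {x x′ y y′} → gap x x′ ≡ gap y y′ → x ≢ y → x′ ≡ x × y′ ≡ y
gap-≡-differ {plus}  {_}     {plus}  {_}     _  x≢y = ⊥-elim (x≢y refl)
gap-≡-differ {minus} {_}     {minus} {_}     _  x≢y = ⊥-elim (x≢y refl)
gap-≡-differ {plus}  {plus}  {minus} {minus} _  _   = refl , refl
gap-≡-differ {plus}  {plus}  {minus} {plus}  ()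
gap-≡-differ {plus}  {minus} {minus} {minus} ()
gap-≡-differ {plus}  {minus} {minus} {plus}  ()
gap-≡-differ {minus} {minus} {plus}  {plus}  _  _   = refl , refl
gap-≡-differ {minus} {minus} {plus}  {minus} ()
gap-≡-differ {minus} {plus}  {plus}  {plus}  ()
gap-≡-differ {minus} {plus}  {plus}  {minus} ()

-- If X 0 ≢ Y 0, equal gaps keep both sequences constant, so X n ≡ X 0 ≢ Y 0.
gap-determined : ∀ (X Y : ℕ → Sign) n →
                 (∀ i → i ≤ n → gap (X i) (X (suc i)) ≡ gap (Y i) (Y (suc i))) →
                 X n ≡ Y 0 → ∀ i → i ≤ suc n → X i ≡ Y i
gap-determined X Y n gaps Xn≡Y0 = aligned
  where
  stuck : X 0 ≢ Y 0 → ∀ i → i ≤ n → X i ≡ X 0 × Y i ≡ Y 0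
  stuck _     zero    _   = refl , refl
  stuck X0≢Y0 (suc i) i<n with stuck X0≢Y0 i (≤-trans (n≤1+n i) i<n)
  ... | Xi≡X0 , Yi≡Y0
      with gap-≡-differ (gaps i (≤-trans (n≤1+n i) i<n)) (λ eq → X0≢Y0 (trans (sym Xi≡X0) (trans eq Yi≡Y0)))
  ...   | X′≡Xi , Y′≡Yi = trans X′≡Xi Xi≡X0 , trans Y′≡Yi Yi≡Y0
  start : X 0 ≡ Y 0
  start with X 0 ≟ Y 0
  ... | yes X0≡Y0 = X0≡Y0
  ... | no  X0≢Y0 = ⊥-elim (X0≢Y0 (trans (sym (proj₁ (stuck X0≢Y0 n ≤-refl))) Xn≡Y0))
  aligned : ∀ i → i ≤ suc n → X i ≡ Y i
  aligned zero    _         = start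
  aligned (suc i) (s≤s i≤n) =
    gap-≡-same (X i)
      (trans (gaps i i≤n) (cong (λ y → gap y (Y (suc i))) (sym (aligned i (≤-trans i≤n (n≤1+n n))))))

runLength-at : ∀ s k i → runLength s (k + i) ≡ gap (runShift s (k + i)) (runShift s (k + suc i))
runLength-at s k i = cong (λ j → gap (runShift s (k + i)) (runShift s j)) (sym (+-suc k i))

paperfolding-runsOverlapFree : ∀ s → Paperfolding s → RunsOverlapFree s
paperfolding-runsOverlapFree s pf a x (p , start , runs) with runStart⇒runBegin s (proj₁ (pf 1)) start
... | k , refl = pairSigns-aperiodic k shifts-agree
  where
  L = suc (length x)
  lengths-agree : ∀ i → i ≤ L → runLength s (k + i) ≡ runLength s (k + L + i)
  lengths-agree = overlap-period (runLength s) k a x (runsAt-runBegin s (proj₁ (pf 1)) k _ runs)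
  shifts-agree : ∀ i → i ≤ suc L → runShift s (k + i) ≡ runShift s (k + L + i)
  shifts-agree = gap-determined (λ i → runShift s (k + i)) (λ i → runShift s (k + L + i)) L
    (λ i i≤L → trans (sym (runLength-at s k i)) (trans (lengths-agree i i≤L) (runLength-at s (k + L) i)))
    (cong (runShift s) (sym (+-identityʳ (k + L))))
  -- runShift s 0 is not a pair sign, so an overlap starting at the first run constrains one
  -- pair sign fewer, but that window starts at the even position 0.
  pairSigns-aperiodic : ∀ k → (∀ i → i ≤ suc L → runShift s (k + i) ≡ runShift s (k + L + i)) → ⊥
  pairSigns-aperiodic zero agree =
    no-period-from-even (pairSign-paperfolding pf) {k = 0} (s≤s z≤n) ≤-refl λ i i<1+L →
      trans (cong (runShift s) (trans (cong suc (+-comm i L)) (sym (+-suc L i)))) (sym (agree (suc i) i<1+L))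
  pairSigns-aperiodic (suc k′) agree =
    no-period (pairSign-paperfolding pf) {p = k′} (s≤s z≤n) ≤-refl λ i i<2+L →
      trans (cong (pairSign s) (trans (+-assoc k′ i L) (trans (cong (k′ +_) (+-comm i L)) (sym (+-assoc k′ L i)))))
            (sym (agree i (≤-pred i<2+L)))

-- P_f as a weaving

weave : Sign → List Sign → List Sign
weave a []       = a ∷ []
weave a (x ∷ xs) = a ∷ x ∷ weave (opposite a) xs

weave-++ : ∀ a L b M → weave a (L ++ b ∷ M) ≡ weave a L ++ b ∷ weave (opposite^ (suc (length L)) a) M
weave-++ a []       b M = refl
weave-++ a (x ∷ L) b M = cong (λ t → a ∷ x ∷ t) (trans (weave-++ (opposite a) L b M)
  (cong (λ c → weave (opposite a) L ++ b ∷ weave (opposite c) M) (opposite^-opposite (length L) a)))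

negRev-++ : ∀ xs ys → negRev (xs ++ ys) ≡ negRev ys ++ negRev xs
negRev-++ xs ys = trans (cong (map opposite) (reverse-++ xs ys)) (map-++ opposite (reverse ys) (reverse xs))

length-negRev : ∀ xs → length (negRev xs) ≡ length xs
length-negRev xs = trans (length-map opposite (reverse xs)) (length-reverse xs)

negRev-weave : ∀ a L → negRev (weave a L) ≡ weave (opposite^ (suc (length L)) a) (negRev L)
negRev-weave a []       = refl
negRev-weave a (x ∷ xs) = begin
    negRev (a ∷ x ∷ weave (opposite a) xs)
  ≡⟨ negRev-++ (a ∷ x ∷ []) (weave (opposite a) xs) ⟩
    negRev (weave (opposite a) xs) ++ opposite x ∷ opposite a ∷ []
  ≡⟨ cong (_++ opposite x ∷ opposite a ∷ []) (negRev-weave (opposite a) xs) ⟩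
    weave c (negRev xs) ++ opposite x ∷ opposite a ∷ []
  ≡˘⟨ cong (λ t → weave c (negRev xs) ++ opposite x ∷ t ∷ []) last-sign ⟩
    weave c (negRev xs) ++ opposite x ∷ weave (opposite^ (suc (length (negRev xs))) c) []
  ≡˘⟨ weave-++ c (negRev xs) (opposite x) [] ⟩
    weave c (negRev xs ++ opposite x ∷ [])
  ≡˘⟨ cong (weave c) (negRev-++ (x ∷ []) xs) ⟩
    weave c (negRev (x ∷ xs))
  ≡⟨ cong (λ c′ → weave c′ (negRev (x ∷ xs))) (cong opposite (opposite^-opposite n a)) ⟩
    weave (opposite^ (suc (suc n)) a) (negRev (x ∷ xs))
  ∎
  where
  open ≡-Reasoning
  n = length xs
  c = opposite^ (suc n) (opposite a)
  last-sign : opposite^ (suc (length (negRev xs))) c ≡ opposite a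
  last-sign = begin
    opposite^ (suc (length (negRev xs))) c   ≡⟨ cong (λ m → opposite^ (suc m) c) (length-negRev xs) ⟩
    opposite^ (suc n) c                      ≡⟨ opposite^-+ (suc n) (suc n) (opposite a) ⟩
    opposite^ (suc n + suc n) (opposite a)   ≡⟨ opposite^-even (suc n) (opposite a) ⟩
    opposite a                               ∎

weave-unfold : ∀ a L b → weave a L ++ b ∷ negRev (weave a L) ≡ weave a (L ++ b ∷ negRev L)
weave-unfold a L b =
  trans (cong (λ t → weave a L ++ b ∷ t) (negRev-weave a L)) (sym (weave-++ a L b (negRev L)))

Pacc-weave : ∀ a acc g → Pacc (weave a acc) g ≡ weave a (Pacc acc g)
Pacc-weave a acc []      = refl
Pacc-weave a acc (b ∷ g) =
  trans (cong (λ l → Pacc l g) (weave-unfold a acc b)) (Pacc-weave a (acc ++ b ∷ negRev acc) g)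

P-∷ : ∀ a g → P (a ∷ g) ≡ weave a (P g)
P-∷ a g = Pacc-weave a [] g

Pacc-∷ʳ : ∀ acc g b → Pacc acc (g ++ b ∷ []) ≡ Pacc acc g ++ b ∷ negRev (Pacc acc g)
Pacc-∷ʳ acc []      b = refl
Pacc-∷ʳ acc (a ∷ g) b = Pacc-∷ʳ (acc ++ a ∷ negRev acc) g b

IsPrefixOf-cong : ∀ (l : List Sign) {s s′} → (∀ i → s i ≡ s′ i) → IsPrefixOf l s → IsPrefixOf l s′
IsPrefixOf-cong []      s≗s′ _          = tt
IsPrefixOf-cong (x ∷ l) s≗s′ (s0 , rest) = trans (sym (s≗s′ 0)) s0 , IsPrefixOf-cong l (λ i → s≗s′ (suc i)) rest

IsPrefixOf-++ : ∀ (xs ys : List Sign) {s} → IsPrefixOf (xs ++ ys) s →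
                IsPrefixOf xs s × IsPrefixOf ys (λ i → s (length xs + i))
IsPrefixOf-++ []       ys pre          = tt , pre
IsPrefixOf-++ (x ∷ xs) ys (s0 , rest) = (s0 , proj₁ (IsPrefixOf-++ xs ys rest)) , proj₂ (IsPrefixOf-++ xs ys rest)

weave-prefix-evens : ∀ a L {s} → IsPrefixOf (weave a L) s → ∀ m → m ≤ length L → s (m + m) ≡ opposite^ m a
weave-prefix-evens a []       (s0 , _) zero _ = s0
weave-prefix-evens a (x ∷ L) (s0 , _) zero _ = s0
weave-prefix-evens a (x ∷ L) {s} (_ , _ , rest) (suc m) (s≤s m≤L) =
  trans (cong s ([1+m]+[1+m]≡2+[m+m] m)) (trans (weave-prefix-evens (opposite a) L rest m m≤L) (opposite^-opposite m a))

weave-prefix-odds : ∀ a L {s} → IsPrefixOf (weave a L) s → IsPrefixOf L (odds s)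
weave-prefix-odds a []       _              = tt
weave-prefix-odds a (x ∷ L) {s} (_ , s1 , rest) =
  s1 , IsPrefixOf-cong L (λ i → cong s (sym (cong suc ([1+m]+[1+m]≡2+[m+m] i)))) (weave-prefix-odds (opposite a) L rest)

weave-prefix : ∀ a L {s} → (∀ m → s (m + m) ≡ opposite^ m a) → IsPrefixOf L (odds s) → IsPrefixOf (weave a L) s
weave-prefix a []       evens _           = evens 0 , tt
weave-prefix a (x ∷ L) {s} evens (s1 , rest) =
  evens 0 , s1 , weave-prefix (opposite a) L
    (λ m → trans (cong s (sym ([1+m]+[1+m]≡2+[m+m] m))) (trans (evens (suc m)) (sym (opposite^-opposite m a))))
    (IsPrefixOf-cong L (λ i → cong s (cong suc ([1+m]+[1+m]≡2+[m+m] i))) rest)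

length-weave : ∀ a L → length L < length (weave a L)
length-weave a []      = s≤s z≤n
length-weave a (x ∷ L) = s≤s (≤-trans (length-weave (opposite a) L) (n≤1+n _))

length-P : ∀ k f → k ≤ length (P (takeSeq k f))
length-P zero    f = z≤n
length-P (suc k) f rewrite P-∷ (f 0) (takeSeq k (λ i → f (suc i))) =
  ≤-trans (s≤s (length-P k (λ i → f (suc i)))) (length-weave (f 0) (P (takeSeq k (λ i → f (suc i)))))

prefixes⇒paperfolding : ∀ (f s : ℕ → Sign) → (∀ k → IsPrefixOf (P (takeSeq k f)) s) → Paperfolding s
prefixes⇒paperfolding f s pre zero    = tt
prefixes⇒paperfolding f s pre (suc n) =
  alternating , prefixes⇒paperfolding (λ i → f (suc i)) (odds s) (λ k → weave-prefix-odds (f 0) _ (woven k)) n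
  where
  woven : ∀ k → IsPrefixOf (weave (f 0) (P (takeSeq k (λ i → f (suc i))))) s
  woven k = subst (λ l → IsPrefixOf l s) (P-∷ (f 0) (takeSeq k (λ i → f (suc i)))) (pre (suc k))
  evens : ∀ m → s (m + m) ≡ opposite^ m (f 0)
  evens m = weave-prefix-evens (f 0) _ (woven m) m (length-P m (λ i → f (suc i)))
  alternating : Alternating s
  alternating m =
    trans (cong s (sym ([1+m]+[1+m]≡2+[m+m] m))) (trans (evens (suc m)) (cong opposite (sym (evens m))))

interleave : (ℕ → Sign) → (ℕ → Sign) → ℕ → Sign
interleave e o zero          = e 0
interleave e o (suc zero)    = o 0
interleave e o (suc (suc i)) = interleave (λ m → e (suc m)) (λ m → o (suc m)) i

interleave-even : ∀ e o m → interleave e o (m + m) ≡ e m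
interleave-even e o zero    = refl
interleave-even e o (suc m) rewrite +-suc m m = interleave-even (λ m → e (suc m)) (λ m → o (suc m)) m

interleave-odd : ∀ e o m → interleave e o (suc (m + m)) ≡ o m
interleave-odd e o zero    = refl
interleave-odd e o (suc m) rewrite +-suc m m = interleave-odd (λ m → e (suc m)) (λ m → o (suc m)) m

-- paperfoldUpTo n g is correct on the positions below n; its values at fuel 0 are junk.
paperfoldUpTo : ℕ → (ℕ → Sign) → ℕ → Sign
paperfoldUpTo zero    g _ = g 0
paperfoldUpTo (suc n) g   = interleave (λ m → opposite^ m (g 0)) (paperfoldUpTo n (λ i → g (suc i)))

paperfoldUpTo-stable : ∀ n n′ g i → i < n → i < n′ → paperfoldUpTo n g i ≡ paperfoldUpTo n′ g i
paperfoldUpTo-stable (suc n) (suc n′) g i i<n i<n′ with parity i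
... | even m = trans (interleave-even _ _ m) (sym (interleave-even _ _ m))
... | odd m  = trans (interleave-odd _ _ m)
                 (trans (paperfoldUpTo-stable n n′ (λ i → g (suc i)) m (m<n i<n) (m<n i<n′))
                        (sym (interleave-odd _ _ m)))
  where
  m<n : ∀ {n} → suc (m + m) < suc n → m < n
  m<n (s≤s 2m<n) = ≤-trans (s≤s (m≤m+n m m)) 2m<n

paperfold : (ℕ → Sign) → ℕ → Sign
paperfold g i = paperfoldUpTo (suc i) g i

paperfold-evens : ∀ g m → paperfold g (m + m) ≡ opposite^ m (g 0)
paperfold-evens g m = interleave-even _ _ m

paperfold-odds : ∀ g m → odds (paperfold g) m ≡ paperfold (λ i → g (suc i)) m
paperfold-odds g m =
  trans (interleave-odd _ _ m) (paperfoldUpTo-stable (suc (m + m)) (suc m) (λ i → g (suc i)) m (s≤s (m≤m+n m m)) ≤-refl)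

paperfold-prefix : ∀ k g → IsPrefixOf (P (takeSeq k g)) (paperfold g)
paperfold-prefix zero    g = tt
paperfold-prefix (suc k) g =
  subst (λ l → IsPrefixOf l (paperfold g)) (sym (P-∷ (g 0) (takeSeq k (λ i → g (suc i)))))
    (weave-prefix (g 0) _ (paperfold-evens g)
      (IsPrefixOf-cong _ (λ m → sym (paperfold-odds g m)) (paperfold-prefix k (λ i → g (suc i)))))

-- Finite words


overlap-assoc : ∀ (a : ℕ) x vs → a ∷ x ++ (a ∷ x ++ (a ∷ vs)) ≡ (a ∷ x ++ (a ∷ x ++ (a ∷ []))) ++ vs
overlap-assoc a x vs = cong (a ∷_) (trans (cong (λ t → x ++ (a ∷ t)) (sym (++-assoc x (a ∷ []) vs)))
                                          (sym (++-assoc x (a ∷ x ++ (a ∷ [])) vs)))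

lastOr : Sign → List Sign → Sign
lastOr c []       = c
lastOr c (y ∷ ys) = lastOr y ys

runsAt-∷ : ∀ s p k c ws → 1 ≤ k → (∀ j → j < k → s (p + j) ≡ c) → s (p + k) ≢ c →
           RunsAt s (p + k) ws → RunsAt s p (k ∷ ws)
runsAt-∷ s p k c ws k≥1 const end rest =
  k≥1 , (λ j j<k → trans (const j j<k) (sym sp≡c)) , (λ eq → end (trans eq sp≡c)) , rest
  where
  sp≡c : s p ≡ c
  sp≡c = trans (cong s (sym (+-identityʳ p))) (const 0 k≥1)

runsFrom-runsAt : ∀ s ys c k p → 1 ≤ k → (∀ j → j < k → s (p + j) ≡ c) →
                  IsPrefixOf ys (λ i → s (p + k + i)) → s (p + k + length ys) ≢ lastOr c ys →
                  RunsAt s p (runsFrom c k ys)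
runsFrom-runsAt s [] c k p k≥1 const _ end =
  runsAt-∷ s p k c [] k≥1 const (λ eq → end (trans (cong s (+-identityʳ (p + k))) eq)) tt
runsFrom-runsAt s (y ∷ ys) c k p k≥1 const (sk≡y , rest) end with y ≟ c
... | yes refl =
  runsFrom-runsAt s ys c (suc k) p (s≤s z≤n) const′ (IsPrefixOf-cong ys (λ i → cong s (shift i)) rest)
    (λ eq → end (trans (cong s (shift (length ys))) eq))
  where
  shift : ∀ i → p + k + suc i ≡ p + suc k + i
  shift i = trans (+-suc (p + k) i) (cong (_+ i) (sym (+-suc p k)))
  const′ : ∀ j → j < suc k → s (p + j) ≡ c
  const′ j (s≤s j≤k) with m≤n⇒m<n∨m≡n j≤k
  ... | inj₁ j<k  = const j j<k
  ... | inj₂ refl = trans (cong s (sym (+-identityʳ (p + j)))) sk≡y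
... | no y≢c =
  runsAt-∷ s p k c _ k≥1 const (λ eq → y≢c (trans (sym (trans (cong s (sym (+-identityʳ (p + k)))) sk≡y)) eq))
    (runsFrom-runsAt s ys y 1 (p + k) (s≤s z≤n) (λ { zero _ → sk≡y ; (suc j) (s≤s ()) })
      (IsPrefixOf-cong ys (λ i → cong s (sym (+-assoc (p + k) 1 i))) rest)
      (λ eq → end (trans (cong s (sym (+-assoc (p + k) 1 (length ys)))) eq)))

runsAt-++ˡ : ∀ s p us vs → RunsAt s p (us ++ vs) → RunsAt s p us
runsAt-++ˡ s p []       vs _                        = tt
runsAt-++ˡ s p (l ∷ us) vs (l≥1 , const , end , rest) = l≥1 , const , end , runsAt-++ˡ s (p + l) us vs rest

runsAt-++ʳ : ∀ s p us vs → RunStart s p → RunsAt s p (us ++ vs) → RunFactor s vs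
runsAt-++ʳ s p []             vs start runs = p , start , runs
runsAt-++ʳ s p (zero ∷ us)    vs start (() , _)
runsAt-++ʳ s p (suc l ∷ us)   vs start (_ , const , end , rest) =
  runsAt-++ʳ s (p + suc l) us vs (inj₂ (p + l , +-suc p l , λ eq → end (trans (sym eq) (const l ≤-refl)))) rest

runFactor-infix : ∀ s us ws vs → RunsAt s 0 (us ++ ws ++ vs) → RunFactor s ws
runFactor-infix s us ws vs runs with runsAt-++ʳ s 0 us (ws ++ vs) (inj₁ refl) runs
... | q , start , runs′ = q , start , runsAt-++ˡ s q ws vs runs′

extend : List Sign → Sign → ℕ → Sign
extend []      d _       = d
extend (x ∷ l) d zero    = x
extend (x ∷ l) d (suc i) = extend l d i

takeSeq-extend : ∀ l d → takeSeq (length l) (extend l d) ≡ l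
takeSeq-extend []      d = refl
takeSeq-extend (x ∷ l) d = cong (x ∷_) (takeSeq-extend l d)

runsAt-runLengths : ∀ s z zs → IsPrefixOf (z ∷ zs) s → s (suc (length zs)) ≢ lastOr z zs →
                    RunsAt s 0 (runLengths (z ∷ zs))
runsAt-runLengths s z zs (s0 , rest) end =
  runsFrom-runsAt s zs z 1 0 (s≤s z≤n) (λ { zero _ → s0 ; (suc j) (s≤s ()) }) rest end

P-prefix-paperfold : ∀ f b → IsPrefixOf (P f ++ b ∷ negRev (P f)) (paperfold (extend (f ++ b ∷ []) b))
P-prefix-paperfold f b =
  subst (λ l → IsPrefixOf l (paperfold g)) (trans (cong P (takeSeq-extend (f ++ b ∷ []) b)) (Pacc-∷ʳ [] f b))
    (paperfold-prefix (length (f ++ b ∷ [])) g)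
  where
  g = extend (f ++ b ∷ []) b

-- Appending b, the opposite of the last letter of P f, completes the last run of P f inside s.
P-runsOverlapFree : (f : List Sign) → OverlapFree (runLengths (P f))
P-runsOverlapFree f (us , vs , a , x , eq) with P f in Pf≡
... | []     with () ← ++-conicalʳ us _ (sym eq)
... | z ∷ zs =
  paperfolding-runsOverlapFree s (prefixes⇒paperfolding g s (λ k → paperfold-prefix k g)) a x
    (runFactor-infix s us _ vs (subst (RunsAt s 0) (trans eq (cong (us ++_) (overlap-assoc a x vs)))
      (runsAt-runLengths s z zs (proj₁ split) λ eq′ → s≢opposite[s] (lastOr z zs) (trans (sym eq′) after))))
  where
  b = opposite (lastOr z zs)
  g = extend (f ++ b ∷ []) b
  s = paperfold g
  split = IsPrefixOf-++ (z ∷ zs) (b ∷ negRev (z ∷ zs)) {s}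
            (subst (λ l → IsPrefixOf (l ++ b ∷ negRev l) s) Pf≡ (P-prefix-paperfold f b))
  after : s (suc (length zs)) ≡ b
  after = trans (cong s (sym (+-identityʳ (suc (length zs))))) (proj₁ (proj₂ split))

theorem5 : ((f : List Sign) → OverlapFree (runLengths (P f)))
         × ((f : ℕ → Sign) → (s : ℕ → Sign)
             → ((n : ℕ) → IsPrefixOf (P (takeSeq n f)) s)
             → RunsOverlapFree s)
theorem5 = P-runsOverlapFree , λ f s pre → paperfolding-runsOverlapFree s (prefixes⇒paperfolding f s pre)
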